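{- Let $n \in \mathbb{N}$ and let $\sigma'$ be a prefix normal word chain generator of length $n$ with $\sigma'[i] = n$ for some $i \in [2,n-1]$. Then the permutation $\sigma = \sigma'[1..i-2]\, \sigma'[i]\, \sigma'[i-1]\, \sigma'[i+1..n]$ (obtained from $\sigma'$ by swapping the entries at positions $i-1$ and $i$, thus moving $n$ one position to the left) is a prefix normal word chain generator.
   Context: Words are over $\{0,1\}$. For a word $w$, $|w|_1$ is the number of $1$s and $\mathrm{pref}_k(w)$ the prefix of length $k$; a factor is a contiguous subword. A word $w$ is prefix normal if every factor $v$ of $w$ satisfies $|v|_1 \le |\mathrm{pref}_{|v|}(w)|_1$. A permutation $\sigma$ of $[n]$ is written in one-line notation $\sigma[1]\cdots\sigma[n]$ with $\sigma[i]=\sigma(i)$, and $\sigma[a..b]$ denotes the block $\sigma[a]\cdots\sigma[b]$ (empty if $a>b$). Its word chain $c_\sigma=(c_\sigma[1],\dots,c_\sigma[n+1])$ consists of words of length $n$ with $c_\sigma[1]=1^n$ and $c_\sigma[k+1]$ obtained from $c_\sigma[k]$ by changing the letter at position $\sigma(k)$ from $1$ to $0$. The permutation $\sigma$ is a prefix normal word chain generator if all words $c_\sigma[k]$ are prefix normal. -}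

module Defs where

open import Data.Bool using (Bool; true; false)
open import Data.Nat using (ℕ; zero; suc; _+_; _≤_; _<_; _<?_)
open import Data.Fin using (Fin; fromℕ<; toℕ)
open import Data.List using (List; []; _∷_; take; drop)
open import Data.Vec using (Vec; replicate; toList; _[_]≔_)
open import Data.Fin.Permutation using (Permutation′; _⟨$⟩ʳ_; transpose; _∘ₚ_)
open import Relation.Nullary using (yes; no)

-- A binary word of length n (letters 0 = false, 1 = true).
Word : ℕ → Set
Word n = Vec Bool n

ones : List Bool → ℕ
ones [] = 0
ones (true ∷ w) = suc (ones w)
ones (false ∷ w) = ones w

factor : {n : ℕ} → Word n → ℕ → ℕ → List Bool
factor w s ℓ = take ℓ (drop s (toList w))

pref : {n : ℕ} → Word n → ℕ → List Bool
pref w ℓ = take ℓ (toList w)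

PrefixNormal : {n : ℕ} → Word n → Set
PrefixNormal {n} w =
  (s ℓ : ℕ) → s + ℓ ≤ n → ones (factor w s ℓ) ≤ ones (pref w ℓ)

-- Permutations of [n], represented 0-based as permutations of Fin n;
-- σ ⟨$⟩ʳ k is the 1-based σ(k+1) minus 1.
Perm : ℕ → Set
Perm n = Permutation′ n

-- Word chain, 0-based: chain σ m = c_σ[m+1], for m = 0..n.
-- chain σ 0 = 1^n; chain σ (m+1) is chain σ m with the letter at
-- position σ(m+1) (0-based: σ ⟨$⟩ʳ m) changed to 0.
chain : {n : ℕ} → Perm n → ℕ → Word n
chain {n} σ zero = replicate n true
chain {n} σ (suc m) with m <? n
... | yes m<n = chain σ m [ σ ⟨$⟩ʳ fromℕ< m<n ]≔ false
... | no _ = chain σ m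

PNGenerator : {n : ℕ} → Perm n → Set
PNGenerator {n} σ = (m : ℕ) → m ≤ n → PrefixNormal (chain σ m)

-- σ' with its entries at (0-based) positions a and b swapped:
-- (σ' ∘ transpose a b)(k) = σ'(τ_{ab}(k)).
swapPositions : {n : ℕ} → Perm n → Fin n → Fin n → Perm n
swapPositions σ a b = transpose a b ∘ₚ σ

-- Swapping the adjacent positions a and b = a + 1 of σ' changes only one word of the chain:
-- c_σ[b] is c_σ'[a] with its last letter (position σ'(b) = n) set to 0, while every other
-- c_σ[m] equals c_σ'[m], since the same letters have been zeroed.  Zeroing the last letter
-- keeps a word prefix normal: prefixes shorter than n are unchanged, and any factor not
-- starting at the front is shorter than n and can only lose ones.
module Submission where

open import Defs
open import Data.Bool using (true; false; f≤t; b≤b) renaming (_≤_ to _≤ᵇ_)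
import Data.Bool.Properties as Boolₚ
open import Data.Nat using (ℕ; zero; suc; _+_; _≤_; _<_; _<?_; z≤n; s≤s)
open import Data.Nat.Properties
  using (≤-refl; ≤-trans; ≤-reflexive; <⇒≤; <-trans; <-cmp; _≟_; +-comm; m≤n+m; m≤n⇒m≤1+n;
         m<n⇒m<1+n; m<1+n⇒m≤n; m≤n⇒m<n∨m≡n; module ≤-Reasoning)
open import Data.Fin using (Fin; toℕ; fromℕ<) renaming (zero to fzero; suc to fsuc)
import Data.Fin.Properties as Finₚ
open import Data.Fin.Properties using (toℕ-fromℕ<; fromℕ<-toℕ; toℕ<n) renaming (_≟_ to _≟ᶠ_)
open import Data.Fin.Permutation using (_⟨$⟩ʳ_)
import Data.Fin.Permutation.Components as PC
open import Data.List using (List; []; _∷_; take; drop)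
open import Data.List.Relation.Binary.Pointwise using (Pointwise; []; _∷_)
import Data.List.Relation.Binary.Pointwise.Properties as Pointwiseₚ
open import Data.Vec using (Vec; _∷_; toList; _[_]≔_)
open import Data.Vec.Properties using ([]≔-commutes)
open import Data.Sum using (inj₁; inj₂)
open import Data.Empty using (⊥-elim)
open import Relation.Binary.Core using (Rel)
open import Relation.Binary.PropositionalEquality
  using (_≡_; _≢_; refl; sym; trans; cong; cong₂; subst; module ≡-Reasoning)
open import Relation.Binary.Definitions using (tri<; tri≈; tri>)
open import Relation.Nullary using (yes; no)

transpose-matchˡ : ∀ {n} (i j : Fin n) → PC.transpose i j i ≡ j
transpose-matchˡ i j with i ≟ᶠ i
... | yes _ = refl
... | no i≢i = ⊥-elim (i≢i refl)

transpose-matchʳ : ∀ {n} (i j : Fin n) → PC.transpose i j j ≡ i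
transpose-matchʳ i j with j ≟ᶠ i
... | yes j≡i = j≡i
... | no _ with j ≟ᶠ j
...   | yes _ = refl
...   | no j≢j = ⊥-elim (j≢j refl)

transpose-other : ∀ {n} (i j k : Fin n) → k ≢ i → k ≢ j → PC.transpose i j k ≡ k
transpose-other i j k k≢i k≢j with k ≟ᶠ i
... | yes k≡i = ⊥-elim (k≢i k≡i)
... | no _ with k ≟ᶠ j
...   | yes k≡j = ⊥-elim (k≢j k≡j)
...   | no _ = refl

[]≔-[]≔-comm : ∀ {A : Set} {n} (w : Vec A n) (i j : Fin n) (x : A) →
  (w [ i ]≔ x) [ j ]≔ x ≡ (w [ j ]≔ x) [ i ]≔ x
[]≔-[]≔-comm w i j x with i ≟ᶠ j
... | yes refl = refl
... | no i≢j = []≔-commutes w i j i≢j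

take⁺ : ∀ {A : Set} {r} {R : Rel A r} ℓ {xs ys : List A} →
  Pointwise R xs ys → Pointwise R (take ℓ xs) (take ℓ ys)
take⁺ zero _ = []
take⁺ (suc ℓ) [] = []
take⁺ (suc ℓ) (r ∷ rs) = r ∷ take⁺ ℓ rs

drop⁺ : ∀ {A : Set} {r} {R : Rel A r} s {xs ys : List A} →
  Pointwise R xs ys → Pointwise R (drop s xs) (drop s ys)
drop⁺ zero rs = rs
drop⁺ (suc s) [] = []
drop⁺ (suc s) (_ ∷ rs) = drop⁺ s rs

ones-mono : ∀ {xs ys} → Pointwise _≤ᵇ_ xs ys → ones xs ≤ ones ys
ones-mono [] = z≤n
ones-mono (f≤t ∷ rs) = m≤n⇒m≤1+n (ones-mono rs)
ones-mono (b≤b {false} ∷ rs) = ones-mono rs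
ones-mono (b≤b {true} ∷ rs) = s≤s (ones-mono rs)

toList-[]≔-false : ∀ {n} (w : Word n) (j : Fin n) →
  Pointwise _≤ᵇ_ (toList (w [ j ]≔ false)) (toList w)
toList-[]≔-false (false ∷ w) fzero = b≤b ∷ Pointwiseₚ.refl Boolₚ.≤-refl
toList-[]≔-false (true ∷ w) fzero = f≤t ∷ Pointwiseₚ.refl Boolₚ.≤-refl
toList-[]≔-false (x ∷ w) (fsuc j) = b≤b ∷ toList-[]≔-false w j

take-toList-[]≔ : ∀ {A : Set} {n} (w : Vec A n) (j : Fin n) (x : A) ℓ → ℓ ≤ toℕ j →
  take ℓ (toList (w [ j ]≔ x)) ≡ take ℓ (toList w)
take-toList-[]≔ w j x zero _ = refl
take-toList-[]≔ (y ∷ w) (fsuc j) x (suc ℓ) (s≤s ℓ≤j) = cong (y ∷_) (take-toList-[]≔ w j x ℓ ℓ≤j)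

prefixNormal-[]≔-last : ∀ {n} (w : Word n) (j : Fin n) → toℕ j + 1 ≡ n →
  PrefixNormal w → PrefixNormal (w [ j ]≔ false)
prefixNormal-[]≔-last w j j-last pn zero ℓ _ = ≤-refl
prefixNormal-[]≔-last {n} w j j-last pn (suc s) ℓ s+ℓ≤n = begin
  ones (factor (w [ j ]≔ false) (suc s) ℓ)
    ≤⟨ ones-mono (take⁺ ℓ (drop⁺ (suc s) (toList-[]≔-false w j))) ⟩
  ones (factor w (suc s) ℓ)
    ≤⟨ pn (suc s) ℓ s+ℓ≤n ⟩
  ones (pref w ℓ)
    ≡⟨ cong ones (sym (take-toList-[]≔ w j false ℓ ℓ≤j)) ⟩
  ones (pref (w [ j ]≔ false) ℓ) ∎
  where
  open ≤-Reasoning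
  ℓ≤j : ℓ ≤ toℕ j
  ℓ≤j = m<1+n⇒m≤n (subst (ℓ <_) (trans (sym j-last) (+-comm (toℕ j) 1))
                               (≤-trans (s≤s (m≤n+m ℓ s)) s+ℓ≤n))

module _ {n : ℕ} where

  chain-suc : (σ : Perm n) (k : Fin n) →
    chain σ (suc (toℕ k)) ≡ chain σ (toℕ k) [ σ ⟨$⟩ʳ k ]≔ false
  chain-suc σ k with toℕ k <? n
  ... | yes k<n = cong (λ i → chain σ (toℕ k) [ σ ⟨$⟩ʳ i ]≔ false) (fromℕ<-toℕ k k<n)
  ... | no k≮n = ⊥-elim (k≮n (toℕ<n k))

  chain-cong : (σ ρ : Perm n) {j : ℕ} (m : ℕ) → j ≤ m → chain σ j ≡ chain ρ j →
    (∀ k → j ≤ toℕ k → toℕ k < m → σ ⟨$⟩ʳ k ≡ ρ ⟨$⟩ʳ k) →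
    chain σ m ≡ chain ρ m
  chain-cong σ ρ zero z≤n eq _ = eq
  chain-cong σ ρ {j} (suc m) j≤1+m eq agree with m≤n⇒m<n∨m≡n j≤1+m
  ... | inj₂ refl = eq
  ... | inj₁ (s≤s j≤m)
    with m <? n | chain-cong σ ρ m j≤m eq (λ k j≤k k<m → agree k j≤k (m<n⇒m<1+n k<m))
  ...   | no _ | chainsₘ = chainsₘ
  ...   | yes m<n | chainsₘ = cong₂ (λ w i → w [ i ]≔ false) chainsₘ
      (agree (fromℕ< m<n) (≤-trans j≤m (≤-reflexive (sym (toℕ-fromℕ< m<n))))
                          (s≤s (≤-reflexive (toℕ-fromℕ< m<n))))

swapPositions-other : ∀ {n} (σ' : Perm n) (a b k : Fin n) → k ≢ a → k ≢ b →
  swapPositions σ' a b ⟨$⟩ʳ k ≡ σ' ⟨$⟩ʳ k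
swapPositions-other σ' a b k k≢a k≢b = cong (σ' ⟨$⟩ʳ_) (transpose-other a b k k≢a k≢b)

module AdjacentSwap {n : ℕ} (σ' : Perm n) (a b : Fin n) (a+1≡b : suc (toℕ a) ≡ toℕ b) where

  σ : Perm n
  σ = swapPositions σ' a b

  a<b : toℕ a < toℕ b
  a<b = ≤-reflexive a+1≡b

  chain-below : ∀ m → m ≤ toℕ a → chain σ m ≡ chain σ' m
  chain-below m m≤a = chain-cong σ σ' m z≤n refl λ k _ k<m →
    let k<a = ≤-trans k<m m≤a in
    swapPositions-other σ' a b k (Finₚ.<⇒≢ k<a) (Finₚ.<⇒≢ (<-trans k<a a<b))

  chain-at : chain σ (toℕ b) ≡ chain σ' (toℕ a) [ σ' ⟨$⟩ʳ b ]≔ false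
  chain-at = begin
    chain σ (toℕ b)                         ≡⟨ cong (chain σ) (sym a+1≡b) ⟩
    chain σ (suc (toℕ a))                   ≡⟨ chain-suc σ a ⟩
    chain σ (toℕ a) [ σ ⟨$⟩ʳ a ]≔ false     ≡⟨ cong₂ (λ w i → w [ i ]≔ false)
                                                     (chain-below (toℕ a) ≤-refl)
                                                     (cong (σ' ⟨$⟩ʳ_) (transpose-matchˡ a b)) ⟩
    chain σ' (toℕ a) [ σ' ⟨$⟩ʳ b ]≔ false   ∎
    where open ≡-Reasoning

  chain-after : chain σ (suc (toℕ b)) ≡ chain σ' (suc (toℕ b))
  chain-after = begin
    chain σ (suc (toℕ b))                                        ≡⟨ chain-suc σ b ⟩
    chain σ (toℕ b) [ σ ⟨$⟩ʳ b ]≔ false                          ≡⟨ cong₂ (λ w i → w [ i ]≔ false)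
                                                                          chain-at
                                                                          (cong (σ' ⟨$⟩ʳ_) (transpose-matchʳ a b)) ⟩
    (chain σ' (toℕ a) [ σ' ⟨$⟩ʳ b ]≔ false) [ σ' ⟨$⟩ʳ a ]≔ false ≡⟨ []≔-[]≔-comm _ _ _ false ⟩
    (chain σ' (toℕ a) [ σ' ⟨$⟩ʳ a ]≔ false) [ σ' ⟨$⟩ʳ b ]≔ false ≡⟨ cong (_[ σ' ⟨$⟩ʳ b ]≔ false)
                                                                          (sym (chain-suc σ' a)) ⟩
    chain σ' (suc (toℕ a)) [ σ' ⟨$⟩ʳ b ]≔ false                  ≡⟨ cong (λ m → chain σ' m [ σ' ⟨$⟩ʳ b ]≔ false)
                                                                          a+1≡b ⟩
    chain σ' (toℕ b) [ σ' ⟨$⟩ʳ b ]≔ false                        ≡⟨ sym (chain-suc σ' b) ⟩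
    chain σ' (suc (toℕ b))                                       ∎
    where open ≡-Reasoning

  chain-above : ∀ m → toℕ b < m → chain σ m ≡ chain σ' m
  chain-above m b<m = chain-cong σ σ' m b<m chain-after λ k b<k _ →
    swapPositions-other σ' a b k
      (λ k≡a → Finₚ.<⇒≢ (<-trans a<b b<k) (sym k≡a))
      (λ k≡b → Finₚ.<⇒≢ b<k (sym k≡b))

  chain-≢ : ∀ m → m ≢ toℕ b → chain σ m ≡ chain σ' m
  chain-≢ m m≢b with <-cmp m (toℕ b)
  ... | tri< m<b _ _ = chain-below m (m<1+n⇒m≤n (subst (m <_) (sym a+1≡b) m<b))
  ... | tri≈ _ m≡b _ = ⊥-elim (m≢b m≡b)
  ... | tri> _ _ b<m = chain-above m b<m

  pnGenerator : toℕ (σ' ⟨$⟩ʳ b) + 1 ≡ n → PNGenerator σ' → PNGenerator σ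
  pnGenerator σ'b-last pn m m≤n with m ≟ toℕ b
  ... | no m≢b = subst PrefixNormal (sym (chain-≢ m m≢b)) (pn m m≤n)
  ... | yes refl = subst PrefixNormal (sym chain-at)
          (prefixNormal-[]≔-last _ (σ' ⟨$⟩ʳ b) σ'b-last (pn (toℕ a) (<⇒≤ (toℕ<n a))))

mainTheorem9 : (n : ℕ) (σ' : Perm n) (a b : Fin n) →
    toℕ a + 1 ≡ toℕ b → 1 ≤ toℕ b → toℕ b + 2 ≤ n →
    toℕ (σ' ⟨$⟩ʳ b) + 1 ≡ n →
    PNGenerator σ' →
    PNGenerator (swapPositions σ' a b)
mainTheorem9 n σ' a b a+1≡b _ _ =
  AdjacentSwap.pnGenerator σ' a b (trans (+-comm 1 (toℕ a)) a+1≡b)
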